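{- For every integer $n\ge 1$, the total number $d(n)$ of divisions of a honeycomb strip of length $n$ (into any number of pieces) equals $F_{2n-1}$, where $F_m$ is the $m$-th Fibonacci number ($F_1=F_2=1$, $F_{m+1}=F_m+F_{m-1}$).
   Context: A honeycomb strip of length $n$ consists of $n$ hexagons labelled $1,\dots,n$ in which hexagon $i$ is adjacent exactly with hexagons $i\pm1$ and $i\pm2$ (when these exist); equivalently its inner dual is the graph $P_n^2$ on vertices $1,\dots,n$ with $i\sim j$ iff $1\le|i-j|\le2$. A division is a partition of the hexagons into blocks each inducing a connected subgraph of $P_n^2$ (cuts are made only along edges of hexagons). -}

module Defs where

open import Data.Nat using (ℕ; zero; suc; _+_; _≤_; ∣_-_∣)
open import Data.Fin using (Fin; toℕ)
open import Data.Bool using (Bool; true; false)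
open import Data.Product using (Σ; _×_; _,_; proj₁)
open import Relation.Binary.Bundles using (Setoid)
open import Relation.Binary.PropositionalEquality using (_≡_; refl; sym; trans)

fib : ℕ → ℕ
fib zero = zero
fib (suc zero) = suc zero
fib (suc (suc m)) = fib (suc m) + fib m

-- Adjacency in the inner dual P_n^2 of the honeycomb strip:
-- hexagons i and j are adjacent iff 1 ≤ |i - j| ≤ 2.
Adj : {n : ℕ} → Fin n → Fin n → Set
Adj i j = (1 ≤ ∣ toℕ i - toℕ j ∣) × (∣ toℕ i - toℕ j ∣ ≤ 2)

data Walk {n : ℕ} (B : Fin n → Bool) : Fin n → Fin n → Set where
  here : ∀ {i} → B i ≡ true → Walk B i i
  step : ∀ {i k j} → B i ≡ true → Adj i k → Walk B k j → Walk B i j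

-- A division of the strip of length n: a partition of the hexagons, given as
-- the (Bool-valued) "same block" equivalence relation R, such that each block
-- (the class  R i) induces a connected subgraph of P_n^2.
record IsDivision {n : ℕ} (R : Fin n → Fin n → Bool) : Set where
  field
    R-refl  : ∀ i → R i i ≡ true
    R-sym   : ∀ i j → R i j ≡ true → R j i ≡ true
    R-trans : ∀ i j k → R i j ≡ true → R j k ≡ true → R i k ≡ true
    connected : ∀ i j → R i j ≡ true → Walk (R i) i j

Division : ℕ → Set
Division n = Σ (Fin n → Fin n → Bool) IsDivision

-- Two divisions are the same iff they have the same blocks (pointwise equal
-- same-block relations); proofs of the conditions are irrelevant.
DivisionSetoid : ℕ → Setoid _ _
DivisionSetoid n = record
  { Carrier = Division n
  ; _≈_ = λ D E → ∀ i j → proj₁ D i j ≡ proj₁ E i j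
  ; isEquivalence = record
    { refl = λ i j → refl
    ; sym = λ p i j → sym (p i j)
    ; trans = λ p q i j → trans (p i j) (q i j)
    }
  }

{-# OPTIONS --safe #-}
-- Build the strip by adding hexagons one at a time in front, at position zero.  The new hexagon
-- touches exactly the two previous ones, so it joins the block of its neighbour, or joins the
-- block of the hexagon two back (possible only when those two lie in different blocks), or opens
-- a new block.  Conversely a walk inside a block cannot skip more than one hexagon, so every
-- hexagon with a block mate further back has one among the next two, and every division arises
-- in exactly one way.  If a k counts divisions of k + 1 hexagons and s k those whose two front
-- hexagons are separated, then a (k + 1) = s (k + 1) + a k and s (k + 1) = a k + s k, whence
-- a k = F (2k + 1) and s k = F (2k).
module Submission where

open import Defs
open import Data.Bool using (Bool; true; false)
open import Data.Bool.Properties using (T-≡; ⇔→≡; ¬-not; not-¬)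
open import Data.Empty using (⊥-elim)
open import Data.Fin using (Fin; zero; suc; toℕ)
open import Data.Fin.Properties using (+↔⊎)
open import Data.Nat using (ℕ; zero; suc; _+_; _*_; _∸_; _≤_; _<_; _≡ᵇ_; z≤n; s≤s; z<s)
open import Data.Nat.Properties
  using (_≟_; _<?_; ≤-refl; ≤-trans; +-mono-≤; m<n⇒m<1+n; <⇒≢; <⇒≱; ≮⇒≥;
         ∣-∣-comm; m≤n+∣n-m∣; ≡ᵇ⇒≡; +-suc)
open import Data.Product using (Σ; ∃-syntax; _×_; _,_; proj₁; proj₂)
open import Data.Sum using (_⊎_; inj₁; inj₂)
open import Data.Sum.Function.Propositional using (_⊎-↔_)
open import Function.Bundles using (Inverse; _↔_; mk↔ₛ′; mk⇔; Equivalence)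
open import Function.Construct.Composition using (inverse)
open import Function.Properties.Inverse using (↔-trans; ↔-sym)
open import Relation.Binary.PropositionalEquality
open import Relation.Nullary using (yes; no)
open import Relation.Nullary.Decidable using (dec-true; dec-false)

private
  variable
    n k : ℕ
    b : Bool
    B : Fin n → Bool
    i j l : Fin n

≡ᵇ-true : ∀ {m n} → m ≡ n → (m ≡ᵇ n) ≡ true
≡ᵇ-true {m} {n} = dec-true (m ≟ n)

≡ᵇ-refl : ∀ m → (m ≡ᵇ m) ≡ true
≡ᵇ-refl m = ≡ᵇ-true {m} refl

≡ᵇ-false : ∀ m n → m ≢ n → (m ≡ᵇ n) ≡ false
≡ᵇ-false m n = dec-false (m ≟ n)

≡ᵇ-sound : ∀ m n → (m ≡ᵇ n) ≡ true → m ≡ n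
≡ᵇ-sound m n e = ≡ᵇ⇒≡ m n (Equivalence.from T-≡ e)

≡ᵇ-comm : ∀ m n → (m ≡ᵇ n) ≡ (n ≡ᵇ m)
≡ᵇ-comm m n = ⇔→≡ (mk⇔ (λ e → ≡ᵇ-true (sym (≡ᵇ-sound m n e)))
                        (λ e → ≡ᵇ-true (sym (≡ᵇ-sound n m e))))

Adj-sym : Adj i j → Adj j i
Adj-sym {i = i} {j = j} = subst (λ d → 1 ≤ d × d ≤ 2) (∣-∣-comm (toℕ i) (toℕ j))

walk-source : Walk B i j → B i ≡ true
walk-source (here bᵢ)     = bᵢ
walk-source (step bᵢ _ _) = bᵢ

walk-snoc : Walk B i j → Adj j l → B l ≡ true → Walk B i l
walk-snoc (here bᵢ)     a bₗ = step bᵢ a (here bₗ)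
walk-snoc (step bᵢ a w) a′ bₗ = step bᵢ a (walk-snoc w a′ bₗ)

walk-reverse : Walk B i j → Walk B j i
walk-reverse (here bᵢ)     = here bᵢ
walk-reverse (step {i = i} {k = x} bᵢ a w) =
  walk-snoc (walk-reverse w) (Adj-sym {i = i} {j = x} a) bᵢ

walk-suc : {B : Fin (suc n) → Bool} {i j : Fin n} →
           Walk (λ x → B (suc x)) i j → Walk B (suc i) (suc j)
walk-suc (here bᵢ)     = here bᵢ
walk-suc (step bᵢ a w) = step bᵢ a (walk-suc w)

walk-crosses : ∀ {m} → Walk B i j → toℕ i ≤ m → m < toℕ j →
               ∃[ z ] B z ≡ true × m < toℕ z × toℕ z ≤ m + 2
walk-crosses (here _) i≤m m<i = ⊥-elim (<⇒≱ m<i i≤m)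
walk-crosses {m = m} (step {i = i} {k = x} _ (_ , d≤2) w) i≤m m<j with m <? toℕ x
... | yes m<x = x , walk-source w , m<x ,
                ≤-trans (m≤n+∣n-m∣ (toℕ x) (toℕ i)) (+-mono-≤ i≤m d≤2)
... | no  m≮x = walk-crosses w (≮⇒≥ m≮x) m<j

Connected : (Fin n → Bool) → Set
Connected B = ∀ i j → B i ≡ true → B j ≡ true → Walk B i j

connected-suc : {B : Fin (suc n) → Bool} → Connected (λ x → B (suc x)) →
  (∀ j → B zero ≡ true → B (suc j) ≡ true → ∃[ a ] B (suc a) ≡ true × Adj zero (suc a)) →
  Connected B
connected-suc {B = B} conn near = connect
  where
  from-zero : ∀ j → B zero ≡ true → B (suc j) ≡ true → Walk B zero (suc j)
  from-zero j b₀ bⱼ with near j b₀ bⱼ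
  ... | a , bₐ , adj = step b₀ adj (walk-suc (conn a j bₐ bⱼ))

  connect : Connected B
  connect zero    zero    b₀ _  = here b₀
  connect zero    (suc j) b₀ bⱼ = from-zero j b₀ bⱼ
  connect (suc i) zero    bᵢ b₀ = walk-reverse (from-zero i b₀ bᵢ)
  connect (suc i) (suc j) bᵢ bⱼ = walk-suc (conn i j bᵢ bⱼ)

-- The consequence of connectivity used by the encoding; unlike connectivity, it is obviously
-- inherited by the restriction to the hexagons behind the front one.
Linked : (Fin n → Fin n → Bool) → Set
Linked R = ∀ i j → R i j ≡ true → toℕ i < toℕ j →
           ∃[ z ] R i z ≡ true × toℕ i < toℕ z × toℕ z ≤ toℕ i + 2

record IsLinkedEquivalence {n} (R : Fin n → Fin n → Bool) : Set where
  field
    R-refl  : ∀ i → R i i ≡ true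
    R-sym   : ∀ i j → R i j ≡ true → R j i ≡ true
    R-trans : ∀ i j k → R i j ≡ true → R j k ≡ true → R i k ≡ true
    linked  : Linked R

  R-comm : ∀ i j → R i j ≡ R j i
  R-comm i j = ⇔→≡ (mk⇔ (R-sym i j) (R-sym j i))

  R-cong : ∀ {i j} x → R i j ≡ true → R i x ≡ R j x
  R-cong {i} {j} x rᵢⱼ = ⇔→≡ (mk⇔ (R-trans j i x (R-sym i j rᵢⱼ)) (R-trans i j x rᵢⱼ))

division-isLinkedEquivalence : {R : Fin n → Fin n → Bool} → IsDivision R → IsLinkedEquivalence R
division-isLinkedEquivalence D = record
  { R-refl  = R-refl
  ; R-sym   = R-sym
  ; R-trans = R-trans
  ; linked  = λ i j rᵢⱼ → walk-crosses (connected i j rᵢⱼ) ≤-refl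
  }
  where open IsDivision D

restrict : (Fin (suc n) → Fin (suc n) → Bool) → Fin n → Fin n → Bool
restrict R i j = R (suc i) (suc j)

restrict-isLinkedEquivalence : {R : Fin (suc n) → Fin (suc n) → Bool} →
  IsLinkedEquivalence R → IsLinkedEquivalence (restrict R)
restrict-isLinkedEquivalence {R = R} L = record
  { R-refl  = λ i → R-refl (suc i)
  ; R-sym   = λ i j → R-sym (suc i) (suc j)
  ; R-trans = λ i j k → R-trans (suc i) (suc j) (suc k)
  ; linked  = restricted-linked
  }
  where
  open IsLinkedEquivalence L
  restricted-linked : Linked (restrict R)
  restricted-linked i j r i<j with linked (suc i) (suc j) r (s≤s i<j)
  ... | suc z , r′ , s≤s i<z , s≤s z≤ = z , r′ , i<z , z≤

-- Code k b describes a division of hexagons 0 … k, hexagon zero being the one added last;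
-- b says whether hexagons zero and one share a block.
data Code : ℕ → Bool → Set where
  start : Code 0 true
  join₁ : Code k b → Code (suc k) true
  join₂ : Code k false → Code (suc k) false
  fresh : Code k b → Code (suc k) false

AnyCode : ℕ → Set
AnyCode k = Σ Bool (Code k)

-- A block is labelled by the stage at which it was opened, so a new label exceeds all old ones.
label : Code k b → Fin (suc k) → ℕ
label start             zero    = 0
label (join₁ c)         (suc i) = label c i
label (join₂ c)         (suc i) = label c i
label (fresh c)         (suc i) = label c i
label (join₁ c)         zero    = label c zero
label (join₂ {suc k} c) zero    = label c (suc zero)
label (fresh {k} c)     zero    = suc k

labelOf : AnyCode k → Fin (suc k) → ℕ
labelOf (_ , c) = label c

label-< : (c : Code k b) (i : Fin (suc k)) → label c i < suc k
label-< start             zero    = z<s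
label-< (join₁ c)         zero    = m<n⇒m<1+n (label-< c zero)
label-< (join₂ {suc k} c) zero    = m<n⇒m<1+n (label-< c (suc zero))
label-< (fresh c)         zero    = ≤-refl
label-< (join₁ c)         (suc i) = m<n⇒m<1+n (label-< c i)
label-< (join₂ c)         (suc i) = m<n⇒m<1+n (label-< c i)
label-< (fresh c)         (suc i) = m<n⇒m<1+n (label-< c i)

label-fresh : (c : Code k b) (i : Fin (suc k)) → label c i ≢ suc k
label-fresh c i = <⇒≢ (label-< c i)

fresh-separated : (c : Code k b) (i : Fin (suc k)) → (suc k ≡ᵇ label c i) ≡ false
fresh-separated c i = ≡ᵇ-false _ _ (λ e → label-fresh c i (sym e))

sameLabel : (Fin n → ℕ) → Fin n → Fin n → Bool
sameLabel f i j = f i ≡ᵇ f j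

flag-sameLabel : (c : Code (suc k) b) → b ≡ sameLabel (label c) zero (suc zero)
flag-sameLabel (join₁ c)         = sym (≡ᵇ-refl (label c zero))
flag-sameLabel (join₂ {suc k} c) =
  trans (flag-sameLabel c) (≡ᵇ-comm (label c zero) (label c (suc zero)))
flag-sameLabel (fresh c)         = sym (fresh-separated c zero)

blocks-connected : (c : Code k b) (r : ℕ) → Connected (λ x → r ≡ᵇ label c x)
blocks-connected start r zero zero b₀ _ = here b₀
blocks-connected (join₁ c) r =
  connected-suc (blocks-connected c r) λ _ b₀ _ → zero , b₀ , (s≤s z≤n , s≤s z≤n)
blocks-connected (join₂ {suc k} c) r =
  connected-suc (blocks-connected c r) λ _ b₀ _ → suc zero , b₀ , (s≤s z≤n , ≤-refl)
blocks-connected (fresh c) r =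
  connected-suc (blocks-connected c r) λ j b₀ bⱼ →
    ⊥-elim (label-fresh c j (trans (sym (≡ᵇ-sound r _ bⱼ)) (≡ᵇ-sound r _ b₀)))

decode : Code k b → Division (suc k)
decode c = sameLabel (label c) , record
  { R-refl    = λ i → ≡ᵇ-refl (label c i)
  ; R-sym     = λ i j e → ≡ᵇ-true (sym (≡ᵇ-sound (label c i) (label c j) e))
  ; R-trans   = λ i j l e e′ →
      ≡ᵇ-true (trans (≡ᵇ-sound (label c i) (label c j) e) (≡ᵇ-sound (label c j) (label c l) e′))
  ; connected = λ i j → blocks-connected c (label c i) i j (≡ᵇ-refl (label c i))
  }

-- The Booleans say whether the new hexagon shares a block with the next one and with the one
-- after.  false, true on a code of flag true contradicts transitivity; it is sent to fresh.
extend : Bool → Bool → AnyCode k → AnyCode (suc k)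
extend true  _    (_ , c)     = true  , join₁ c
extend false true (false , c) = false , join₂ c
extend false _    (_ , c)     = false , fresh c

labelOf-extend-suc : ∀ u v (c : AnyCode k) i → labelOf (extend u v c) (suc i) ≡ labelOf c i
labelOf-extend-suc true  _     _          _ = refl
labelOf-extend-suc false true  (false , _) _ = refl
labelOf-extend-suc false true  (true , _)  _ = refl
labelOf-extend-suc false false _          _ = refl

labelOf-extend-join₂ : (c : AnyCode (suc k)) → proj₁ c ≡ false →
                       labelOf (extend false true c) zero ≡ labelOf c (suc zero)
labelOf-extend-join₂ (false , _) refl = refl

joinsSecond : (Fin (suc (suc k)) → Fin (suc (suc k)) → Bool) → Bool
joinsSecond {zero}  R = false
joinsSecond {suc k} R = R zero (suc (suc zero))

encode : (Fin (suc k) → Fin (suc k) → Bool) → AnyCode k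
encode {zero}  R = true , start
encode {suc k} R = extend (R zero (suc zero)) (joinsSecond R) (encode (restrict R))

joinsSecond-cong : {R S : Fin (suc (suc k)) → Fin (suc (suc k)) → Bool} →
                   (∀ i j → R i j ≡ S i j) → joinsSecond R ≡ joinsSecond S
joinsSecond-cong {zero}  _   = refl
joinsSecond-cong {suc k} R≗S = R≗S zero (suc (suc zero))

encode-cong : {R S : Fin (suc k) → Fin (suc k) → Bool} →
              (∀ i j → R i j ≡ S i j) → encode R ≡ encode S
encode-cong {zero}          _   = refl
encode-cong {suc k} {R} {S} R≗S = begin
  extend (R zero (suc zero)) (joinsSecond R) (encode (restrict R))
    ≡⟨ cong₂ (λ u v → extend u v (encode (restrict R))) (R≗S zero (suc zero)) (joinsSecond-cong R≗S) ⟩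
  extend (S zero (suc zero)) (joinsSecond S) (encode (restrict R))
    ≡⟨ cong (extend _ _) (encode-cong (λ i j → R≗S (suc i) (suc j))) ⟩
  extend (S zero (suc zero)) (joinsSecond S) (encode (restrict S)) ∎
  where open ≡-Reasoning

encode-decode : (c : Code k b) → encode (sameLabel (label c)) ≡ (b , c)
encode-decode start = refl
encode-decode (join₁ c) rewrite encode-decode c | ≡ᵇ-refl (label c zero) = refl
encode-decode (join₂ {suc k} c)
  rewrite encode-decode c
        | ≡ᵇ-comm (label c (suc zero)) (label c zero)
        | sym (flag-sameLabel c)
        | ≡ᵇ-refl (label c (suc zero)) = refl
encode-decode (fresh {zero} c) rewrite encode-decode c | fresh-separated c zero = refl
encode-decode (fresh {suc k} c)
  rewrite encode-decode c | fresh-separated c zero | fresh-separated c (suc zero) = refl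

Agrees : AnyCode k → (Fin (suc k) → Fin (suc k) → Bool) → Set
Agrees c R = ∀ i j → sameLabel (labelOf c) i j ≡ R i j

linked-at-new : {R : Fin (suc (suc k)) → Fin (suc (suc k)) → Bool} {j : Fin (suc k)} →
  Linked R → R zero (suc j) ≡ true → R zero (suc zero) ≡ true ⊎ joinsSecond R ≡ true
linked-at-new {j = j} L r with L zero (suc j) r z<s
... | suc zero ,          r₁ , _ , _ = inj₁ r₁
... | suc (suc zero) ,    r₂ , _ , _ = inj₂ r₂
... | suc (suc (suc _)) , _  , _ , s≤s (s≤s ())

join₂-row : {R : Fin (suc (suc k)) → Fin (suc (suc k)) → Bool} → IsLinkedEquivalence R →
  (c : AnyCode k) → Agrees c (restrict R) → R zero (suc zero) ≡ false → joinsSecond R ≡ true →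
  ∀ j → sameLabel (labelOf (extend false true c)) zero (suc j) ≡ R zero (suc j)
join₂-row {zero}  _ _ _ _ ()
join₂-row {suc k} {R} L c agree r₀₁ r₀₂ j = begin
  labelOf (extend false true c) zero ≡ᵇ labelOf (extend false true c) (suc j)
    ≡⟨ cong₂ _≡ᵇ_ (labelOf-extend-join₂ c separated) (labelOf-extend-suc false true c j) ⟩
  labelOf c (suc zero) ≡ᵇ labelOf c j
    ≡⟨ agree (suc zero) j ⟩
  R (suc (suc zero)) (suc j)
    ≡⟨ R-cong (suc j) (R-sym _ _ r₀₂) ⟩
  R zero (suc j) ∎
  where
  open IsLinkedEquivalence L
  open ≡-Reasoning
  separated : proj₁ c ≡ false
  separated = begin
    proj₁ c                                  ≡⟨ flag-sameLabel (proj₂ c) ⟩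
    sameLabel (labelOf c) zero (suc zero)     ≡⟨ agree zero (suc zero) ⟩
    R (suc zero) (suc (suc zero))             ≡⟨ R-comm _ _ ⟩
    R (suc (suc zero)) (suc zero)             ≡⟨ R-cong (suc zero) (R-sym _ _ r₀₂) ⟩
    R zero (suc zero)                         ≡⟨ r₀₁ ⟩
    false                                     ∎

module _ {R : Fin (suc (suc k)) → Fin (suc (suc k)) → Bool} (L : IsLinkedEquivalence R)
         (c : AnyCode k) (agree : Agrees c (restrict R)) where
  open IsLinkedEquivalence L

  extend-new-row : ∀ j →
    sameLabel (labelOf (extend (R zero (suc zero)) (joinsSecond R) c)) zero (suc j) ≡ R zero (suc j)
  extend-new-row j with R zero (suc zero) in r₀₁ | joinsSecond R in r₀₂
  ... | true  | _     = trans (agree zero j) (R-cong (suc j) (R-sym _ _ r₀₁))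
  ... | false | true  = join₂-row L c agree r₀₁ r₀₂ j
  ... | false | false = trans (fresh-separated (proj₂ c) j) (sym (¬-not unjoined))
    where
    unjoined : R zero (suc j) ≢ true
    unjoined r with linked-at-new linked r
    ... | inj₁ r₁ = not-¬ r₁ r₀₁
    ... | inj₂ r₂ = not-¬ r₂ r₀₂

  private
    u v : Bool
    u = R zero (suc zero)
    v = joinsSecond R
    new : Fin (suc (suc k)) → ℕ
    new = labelOf (extend u v c)

  extend-agrees : Agrees (extend (R zero (suc zero)) (joinsSecond R) c) R
  extend-agrees zero    zero    = trans (≡ᵇ-refl (new zero)) (sym (R-refl zero))
  extend-agrees zero    (suc j) = extend-new-row j
  extend-agrees (suc i) zero    =
    trans (≡ᵇ-comm (new (suc i)) (new zero)) (trans (extend-new-row i) (R-comm zero (suc i)))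
  extend-agrees (suc i) (suc j) =
    trans (cong₂ _≡ᵇ_ (labelOf-extend-suc u v c i) (labelOf-extend-suc u v c j)) (agree i j)

encode-agrees : {R : Fin (suc k) → Fin (suc k) → Bool} →
                IsLinkedEquivalence R → Agrees (encode R) R
encode-agrees {zero}  L zero zero = sym (IsLinkedEquivalence.R-refl L zero)
encode-agrees {suc k} L =
  extend-agrees L _ (encode-agrees (restrict-isLinkedEquivalence L))

codes↔divisions : ∀ k → Inverse (setoid (AnyCode k)) (DivisionSetoid (suc k))
codes↔divisions k = record
  { to        = λ c → decode (proj₂ c)
  ; from      = λ D → encode (proj₁ D)
  ; to-cong   = λ { refl _ _ → refl }
  ; from-cong = encode-cong
  ; inverse   = (λ { {D} refl → encode-agrees (division-isLinkedEquivalence (proj₂ D)) })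
              , (λ { {b , c} D≈c → trans (encode-cong D≈c) (encode-decode c) })
  }

double : ℕ → ℕ
double zero    = zero
double (suc k) = suc (suc (double k))

Σ-Bool↔⊎ : {P : Bool → Set} → Σ Bool P ↔ (P false ⊎ P true)
Σ-Bool↔⊎ = mk↔ₛ′ to from (λ { (inj₁ _) → refl ; (inj₂ _) → refl })
                         (λ { (false , _) → refl ; (true , _) → refl })
  where
  to : Σ Bool _ → _
  to (false , p) = inj₁ p
  to (true  , p) = inj₂ p
  from : _ → Σ Bool _
  from (inj₁ p) = false , p
  from (inj₂ p) = true , p

joined↔ : AnyCode k ↔ Code (suc k) true
joined↔ = mk↔ₛ′ to from (λ { (join₁ c) → refl }) (λ _ → refl)
  where
  to : AnyCode k → Code (suc k) true
  to (_ , c) = join₁ c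
  from : Code (suc k) true → AnyCode k
  from (join₁ {b = b} c) = b , c

separated↔ : (AnyCode k ⊎ Code k false) ↔ Code (suc k) false
separated↔ = mk↔ₛ′ to from (λ { (join₂ c) → refl ; (fresh c) → refl })
                           (λ { (inj₁ _) → refl ; (inj₂ _) → refl })
  where
  to : AnyCode k ⊎ Code k false → Code (suc k) false
  to (inj₁ (_ , c)) = fresh c
  to (inj₂ c)       = join₂ c
  from : Code (suc k) false → AnyCode k ⊎ Code k false
  from (join₂ c) = inj₂ c
  from (fresh {b = b} c) = inj₁ (b , c)

count-separated : ∀ k → Fin (fib (double k)) ↔ Code k false
count           : ∀ k → Fin (fib (suc (double k))) ↔ AnyCode k

count-separated zero    = mk↔ₛ′ (λ ()) (λ ()) (λ ()) (λ ())
count-separated (suc k) = ↔-trans +↔⊎ (↔-trans (count k ⊎-↔ count-separated k) separated↔)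

count zero    =
  mk↔ₛ′ (λ _ → true , start) (λ _ → zero) (λ { (true , start) → refl }) (λ { zero → refl })
count (suc k) =
  ↔-trans +↔⊎ (↔-trans (count-separated (suc k) ⊎-↔ ↔-trans (count k) joined↔) (↔-sym Σ-Bool↔⊎))

double≡2* : ∀ k → double k ≡ 2 * k
double≡2* zero    = refl
double≡2* (suc k) = cong suc (trans (cong suc (double≡2* k)) (sym (+-suc k (k + 0))))

2*[1+k]∸1≡1+double : ∀ k → 2 * suc k ∸ 1 ≡ suc (double k)
2*[1+k]∸1≡1+double k = cong (_∸ 1) (sym (double≡2* (suc k)))

theorem8 : (n : ℕ) → 1 ≤ n → Inverse (setoid (Fin (fib (2 * n ∸ 1)))) (DivisionSetoid n)
theorem8 (suc k) _ rewrite 2*[1+k]∸1≡1+double k = inverse (count k) (codes↔divisions k)
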